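{- Let $G$ be a connected finite simple graph on at least three vertices. Then the $1$-shunt intersection graph $A_1(G)$ is isomorphic to the line graph $L(G)$ if and only if $G$ is a star $K_{1,n}$.
   Context: A $1$-arc of $G$ is an ordered pair $(u,v)$ with $uv\in E(G)$, written $uv$. A $1$-arc $uv$ can be shunted onto the $1$-arc $vw$ if $w\neq u$ and $vw\in E(G)$. The graph $A_1(G)$ has as vertices the $1$-arcs of $G$ that can be shunted onto some other $1$-arc; two distinct vertices are adjacent iff the corresponding $1$-arcs share at least one vertex of $G$. $L(G)$ is the line graph of $G$. -}

module Defs where

open import Data.Nat using (ℕ; zero; suc)
open import Data.Fin using (Fin; zero; suc; _<_; _≟_)
open import Data.Bool using (Bool; true; false; T; not; _∧_; _∨_)
open import Data.Product using (Σ; _×_; _,_; proj₁; proj₂)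
open import Data.Sum using (_⊎_)
open import Relation.Nullary using (¬_)
open import Relation.Nullary.Decidable using (⌊_⌋)
open import Relation.Binary.PropositionalEquality using (_≡_)
open import Relation.Binary.Construct.Closure.ReflexiveTransitive using (Star)
open import Function.Bundles using (_⇔_)

-- A finite simple graph on the vertex set Fin n, with Boolean (hence
-- proof-irrelevant) symmetric irreflexive adjacency.
record SimpleGraph (n : ℕ) : Set where
  field
    adj    : Fin n → Fin n → Bool
    sym    : ∀ u v → adj u v ≡ adj v u
    irrefl : ∀ v → adj v v ≡ false

open SimpleGraph public

Adj : ∀ {n} → SimpleGraph n → Fin n → Fin n → Set
Adj G u v = T (adj G u v)

Connected : ∀ {n} → SimpleGraph n → Set
Connected G = ∀ u v → Star (Adj G) u v

anyFin : ∀ {n} → (Fin n → Bool) → Bool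
anyFin {zero}  f = false
anyFin {suc n} f = f zero ∨ anyFin (λ i → f (suc i))

record _≅_ {V W : Set} (R : V → V → Set) (S : W → W → Set) : Set where
  field
    to       : V → W
    from     : W → V
    from∘to  : ∀ x → from (to x) ≡ x
    to∘from  : ∀ y → to (from y) ≡ y
    adjacent : ∀ x y → R x y ⇔ S (to x) (to y)

ShareVertex : ∀ {n} → Fin n × Fin n → Fin n × Fin n → Set
ShareVertex (u , v) (u' , v') = (u ≡ u' ⊎ u ≡ v') ⊎ (v ≡ u' ⊎ v ≡ v')

-- Line graph L(G): vertices are the edges of G (an edge {u,v} is
-- represented canonically by the ordered pair (u,v) with u < v);
-- distinct edges are adjacent iff they share a vertex.

Edge : ∀ {n} → SimpleGraph n → Set
Edge {n} G = Σ (Fin n × Fin n) (λ p → proj₁ p < proj₂ p × Adj G (proj₁ p) (proj₂ p))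

LAdj : ∀ {n} (G : SimpleGraph n) → Edge G → Edge G → Set
LAdj G e f = ¬ (e ≡ f) × ShareVertex (proj₁ e) (proj₁ f)

ShuntsOnto : ∀ {n} → SimpleGraph n → Fin n → Fin n → Fin n → Bool
ShuntsOnto G u v w = adj G u v ∧ (not ⌊ w ≟ u ⌋ ∧ adj G v w)

Shuntable : ∀ {n} → SimpleGraph n → Fin n → Fin n → Bool
Shuntable G u v = anyFin (ShuntsOnto G u v)

A1Vertex : ∀ {n} → SimpleGraph n → Set
A1Vertex {n} G = Σ (Fin n × Fin n) (λ p → Adj G (proj₁ p) (proj₂ p) × T (Shuntable G (proj₁ p) (proj₂ p)))

A1Adj : ∀ {n} (G : SimpleGraph n) → A1Vertex G → A1Vertex G → Set
A1Adj G a b = ¬ (a ≡ b) × ShareVertex (proj₁ a) (proj₁ b)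

isZero : ∀ {k} → Fin k → Bool
isZero zero    = true
isZero (suc _) = false

starAdj : ∀ {m} → Fin (suc m) → Fin (suc m) → Bool
starAdj u v = (isZero u ∧ not (isZero v)) ∨ (not (isZero u) ∧ isZero v)

starSym : ∀ {m} (u v : Fin (suc m)) → starAdj u v ≡ starAdj v u
starSym zero    zero    = Relation.Binary.PropositionalEquality.refl
starSym zero    (suc v) = Relation.Binary.PropositionalEquality.refl
starSym (suc u) zero    = Relation.Binary.PropositionalEquality.refl
starSym (suc u) (suc v) = Relation.Binary.PropositionalEquality.refl

starIrrefl : ∀ {m} (v : Fin (suc m)) → starAdj v v ≡ false
starIrrefl zero    = Relation.Binary.PropositionalEquality.refl
starIrrefl (suc v) = Relation.Binary.PropositionalEquality.refl

StarGraph : (m : ℕ) → SimpleGraph (suc m)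
StarGraph m = record { adj = starAdj ; sym = starSym ; irrefl = starIrrefl }

IsStar : ∀ {n} → SimpleGraph n → Set
IsStar G = Σ ℕ (λ m → Adj G ≅ Adj (StarGraph m))

module Submission where

-- In a connected graph with at least three vertices every edge uv can be shunted in
-- at least one direction (follow a walk from u to a third vertex until it leaves
-- {u, v}), so choosing such a direction embeds the edges of G into the vertices of
-- A₁(G); a bijection between these finite sets leaves exactly one shuntable
-- direction per edge. If vc is the shuntable direction of an edge, every neighbour y
-- of c can be shunted into c (onto cv, or onto the continuation of vc when y = v),
-- so cy cannot be shunted: every neighbour of c is a leaf, and by connectivity G is
-- a star centred at c. Conversely, in a star with at least two leaves the shuntable
-- arcs are exactly those pointing into the centre, one per edge, and A₁(G) and L(G)
-- are both complete graphs.

open import Defs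
open import Data.Nat using (ℕ; zero; suc; _≤_; s≤s)
open import Data.Nat.Properties using (<-irrefl)
open import Data.Fin using (Fin; zero; suc; _<_; _<?_; _≟_; punchOut)
open import Data.Fin.Properties using (injective⇒≤; punchOut-injective; *↔×; <-irrelevant; <-cmp; <-asym)
open import Data.Fin.Permutation using (transpose)
open import Data.Fin.Permutation.Components using (transpose-inverse)
open import Data.Bool using (Bool; T)
open import Data.Bool.Properties using (T-∧; T-∨; T-irrelevant)
open import Data.Product using (Σ; ∃; _×_; _,_; proj₁; proj₂)
open import Data.Product.Function.NonDependent.Propositional using (_×-⇔_)
open import Data.Sum using (_⊎_; inj₁; inj₂)
open import Data.Sum.Function.Propositional using (_⊎-⇔_)
open import Data.Empty using (⊥; ⊥-elim)
open import Function using (_∘_)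
open import Function.Bundles using (_⇔_; mk⇔; Equivalence; _↔_; Inverse; mk↔ₛ′; Injection)
open import Function.Definitions using (Injective)
import Function.Properties.Equivalence as ⇔
open import Function.Properties.Inverse using (↔-sym; ↔⇒↣)
open import Function.Related.TypeIsomorphisms using (→-cong-⇔)
open import Relation.Nullary using (¬_; Dec; yes; no; Irrelevant)
open import Relation.Nullary.Decidable using (T?; _×-dec_; fromWitnessFalse; toWitnessFalse)
open import Relation.Unary using (Decidable)
open import Relation.Binary.Definitions using (tri<; tri≈; tri>)
open import Relation.Binary.PropositionalEquality using (_≡_; _≢_; refl; trans; cong; cong₂; subst)
import Relation.Binary.PropositionalEquality as ≡
open import Relation.Binary.Construct.Closure.ReflexiveTransitive using (Star; ε; _◅_)

↔-injective : ∀ {A B : Set} (φ : A ↔ B) → Injective _≡_ _≡_ (Inverse.to φ)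
↔-injective φ = Injection.injective (↔⇒↣ φ)

Misses : ∀ {A : Set} → (A → A) → A → Set
Misses h y = ∀ x → h x ≢ y

Fin-injective⇒¬misses : ∀ {N} (h : Fin N → Fin N) → Injective _≡_ _≡_ h → ∀ y → ¬ Misses h y
Fin-injective⇒¬misses {suc N} h h-injective y missed = <-irrefl refl (injective⇒≤ squeeze-injective)
  where
  squeeze : Fin (suc N) → Fin N
  squeeze x = punchOut {i = y} (missed x ∘ ≡.sym)

  squeeze-injective : Injective _≡_ _≡_ squeeze
  squeeze-injective {x} {x'} eq = h-injective (punchOut-injective (missed x ∘ ≡.sym) (missed x' ∘ ≡.sym) eq)

finite-injective⇒¬misses : ∀ {A : Set} {N} → A ↔ Fin N →
                           (h : A → A) → Injective _≡_ _≡_ h → ∀ y → ¬ Misses h y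
finite-injective⇒¬misses φ h h-injective y missed =
  Fin-injective⇒¬misses (to ∘ h ∘ from) (↔-injective (↔-sym φ) ∘ h-injective ∘ ↔-injective φ) (to y)
    (λ i → missed (from i) ∘ ↔-injective φ)
  where open Inverse φ

Σ-≡ : ∀ {A : Set} {P : A → Set} → (∀ {x} → Irrelevant (P x)) →
      {a b : Σ A P} → proj₁ a ≡ proj₁ b → a ≡ b
Σ-≡ P-irrelevant {x , p} {.x , q} refl = cong (x ,_) (P-irrelevant p q)

-- Extending g by the identity outside P reduces this to the finite case.
subset-injective⇒¬misses : ∀ {A : Set} {N} {P : A → Set} → A ↔ Fin N → Decidable P →
                           (∀ {x} → Irrelevant (P x)) →
                           (g : Σ A P → Σ A P) → Injective _≡_ _≡_ g → ∀ y → ¬ Misses g y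
subset-injective⇒¬misses {A = A} {P = P} φ P? P-irrelevant g g-injective (y , py) missed =
  finite-injective⇒¬misses φ extend (extendAt-injective (P? _) (P? _)) y (λ x → extendAt-misses x (P? x))
  where
  extendAt : ∀ x → Dec (P x) → A
  extendAt x (yes p) = proj₁ (g (x , p))
  extendAt x (no _)  = x

  extend : A → A
  extend x = extendAt x (P? x)

  extendAt-injective : ∀ {x x'} (d : Dec (P x)) (d' : Dec (P x')) → extendAt x d ≡ extendAt x' d' → x ≡ x'
  extendAt-injective (yes p) (yes p') eq  = cong proj₁ (g-injective (Σ-≡ P-irrelevant eq))
  extendAt-injective {x} (yes p) (no ¬p') eq  = ⊥-elim (¬p' (subst P eq (proj₂ (g (x , p)))))
  extendAt-injective {x' = x'} (no ¬p) (yes p') eq = ⊥-elim (¬p (subst P (≡.sym eq) (proj₂ (g (x' , p')))))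
  extendAt-injective (no _)  (no _)   eq  = eq

  extendAt-misses : ∀ x (d : Dec (P x)) → extendAt x d ≢ y
  extendAt-misses x (yes p) eq = missed (x , p) (Σ-≡ P-irrelevant eq)
  extendAt-misses x (no ¬p) eq = ¬p (subst P (≡.sym eq) py)

T-anyFin : ∀ {n} {f : Fin n → Bool} → T (anyFin f) ⇔ ∃ λ i → T (f i)
T-anyFin {zero}      = mk⇔ (λ ()) (λ ())
T-anyFin {suc n} {f} = ⇔.trans T-∨ (mk⇔ to from)
  where
  to : T (f zero) ⊎ T (anyFin (f ∘ suc)) → ∃ λ i → T (f i)
  to (inj₁ t) = zero , t
  to (inj₂ t) with i , t' ← Equivalence.to T-anyFin t = suc i , t'

  from : (∃ λ i → T (f i)) → T (f zero) ⊎ T (anyFin (f ∘ suc))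
  from (zero  , t) = inj₁ t
  from (suc i , t) = inj₂ (Equivalence.from T-anyFin (i , t))

module Graph {n : ℕ} (G : SimpleGraph n) where

  Adj-sym : ∀ {u v} → Adj G u v → Adj G v u
  Adj-sym {u} {v} = subst T (SimpleGraph.sym G u v)

  Adj⇒≢ : ∀ {u v} → Adj G u v → u ≢ v
  Adj⇒≢ {v = v} uv refl = subst T (irrefl G v) uv

  CanShunt : Fin n → Fin n → Set
  CanShunt u v = T (Shuntable G u v)

  canShunt : ∀ {u v w} → Adj G u v → w ≢ u → Adj G v w → CanShunt u v
  canShunt {w = w} uv w≢u vw =
    Equivalence.from T-anyFin (w , Equivalence.from T-∧ (uv , Equivalence.from T-∧ (fromWitnessFalse w≢u , vw)))

  shuntTarget : ∀ {u v} → CanShunt u v → ∃ λ w → w ≢ u × Adj G v w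
  shuntTarget {u} {v} s with w , t ← Equivalence.to T-anyFin s =
    let w≢u , vw = Equivalence.to T-∧ (proj₂ (Equivalence.to (T-∧ {adj G u v}) t))
    in w , toWitnessFalse w≢u , vw

  IsEdge : Fin n × Fin n → Set
  IsEdge p = proj₁ p < proj₂ p × Adj G (proj₁ p) (proj₂ p)

  IsEdge? : Decidable IsEdge
  IsEdge? p = (proj₁ p <? proj₂ p) ×-dec T? _

  IsEdge-irrelevant : ∀ {p} → Irrelevant (IsEdge p)
  IsEdge-irrelevant (l , a) (l' , a') = cong₂ _,_ (<-irrelevant l l') (T-irrelevant a a')

  Edge-≡ : {e f : Edge G} → proj₁ e ≡ proj₁ f → e ≡ f
  Edge-≡ = Σ-≡ IsEdge-irrelevant

  A1Vertex-≡ : {x y : A1Vertex G} → proj₁ x ≡ proj₁ y → x ≡ y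
  A1Vertex-≡ = Σ-≡ λ (a , s) (a' , s') → cong₂ _,_ (T-irrelevant a a') (T-irrelevant s s')

  data Joins (e : Edge G) (u v : Fin n) : Set where
    forwards  : proj₁ e ≡ (u , v) → Joins e u v
    backwards : proj₁ e ≡ (v , u) → Joins e u v

  Joins-sym : ∀ {e u v} → Joins e u v → Joins e v u
  Joins-sym (forwards eq) = backwards eq
  Joins-sym (backwards eq) = forwards eq

  Joins-unique : ∀ {e f u v} → Joins e u v → Joins f u v → e ≡ f
  Joins-unique (forwards p) (forwards q) = Edge-≡ (trans p (≡.sym q))
  Joins-unique (backwards p) (backwards q) = Edge-≡ (trans p (≡.sym q))
  Joins-unique {_ , u<v , _} {_ , v<u , _} (forwards refl) (backwards refl) = ⊥-elim (<-asym u<v v<u)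
  Joins-unique {_ , v<u , _} {_ , u<v , _} (backwards refl) (forwards refl) = ⊥-elim (<-asym u<v v<u)

  Joins-injective : ∀ {e u u' v} → Joins e u v → Joins e u' v → u ≡ u'
  Joins-injective (forwards p) (forwards q) = cong proj₁ (trans (≡.sym p) q)
  Joins-injective (backwards p) (backwards q) = cong proj₂ (trans (≡.sym p) q)
  Joins-injective (forwards p) (backwards q) = let r = trans (≡.sym p) q in trans (cong proj₁ r) (cong proj₂ r)
  Joins-injective (backwards p) (forwards q) = let r = trans (≡.sym p) q in trans (cong proj₂ r) (cong proj₁ r)

  edgeOf : ∀ u v → Adj G u v → Edge G
  edgeOf u v uv with <-cmp u v
  ... | tri< u<v _ _ = (u , v) , u<v , uv
  ... | tri≈ _ u≡v _ = ⊥-elim (Adj⇒≢ uv u≡v)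
  ... | tri> _ _ v<u = (v , u) , v<u , Adj-sym uv

  edgeOf-joins : ∀ u v (uv : Adj G u v) → Joins (edgeOf u v uv) u v
  edgeOf-joins u v uv with <-cmp u v
  ... | tri< _ _ _   = forwards refl
  ... | tri≈ _ u≡v _ = ⊥-elim (Adj⇒≢ uv u≡v)
  ... | tri> _ _ _   = backwards refl

  arcEdge : A1Vertex G → Edge G
  arcEdge ((u , v) , uv , _) = edgeOf u v uv

  arcEdge-joins : ∀ x → Joins (arcEdge x) (proj₁ (proj₁ x)) (proj₂ (proj₁ x))
  arcEdge-joins ((u , v) , uv , _) = edgeOf-joins u v uv

Spoke : ∀ {V : Set} → V → V → V → Set
Spoke c x y = x ≢ y × (x ≡ c ⊎ y ≡ c)

IsCentre : ∀ {V : Set} → (V → V → Set) → V → Set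
IsCentre R c = ∀ x y → R x y ⇔ Spoke c x y

StarGraph-centre : ∀ {m} → IsCentre (Adj (StarGraph m)) zero
StarGraph-centre zero    zero    = mk⇔ (λ ()) (λ (0≢0 , _) → 0≢0 refl)
StarGraph-centre zero    (suc y) = mk⇔ (λ _ → (λ ()) , inj₁ refl) _
StarGraph-centre (suc x) zero    = mk⇔ (λ _ → (λ ()) , inj₂ refl) _
StarGraph-centre (suc x) (suc y) = mk⇔ (λ ()) λ { (_ , inj₁ ()) ; (_ , inj₂ ()) }

module _ {V W : Set} (φ : V ↔ W) where
  open Inverse φ

  ↔-preserves-Spoke : ∀ {c d x y} → to c ≡ d → Spoke c x y ⇔ Spoke d (to x) (to y)
  ↔-preserves-Spoke refl = →-cong-⇔ ≡-⇔ ⇔.refl ×-⇔ (≡-⇔ ⊎-⇔ ≡-⇔)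
    where
    ≡-⇔ : ∀ {x y} → x ≡ y ⇔ to x ≡ to y
    ≡-⇔ = mk⇔ (cong to) (↔-injective φ)

  ↔⇒≅ : {R : V → V → Set} {S : W → W → Set} → (∀ x y → R x y ⇔ S (to x) (to y)) → R ≅ S
  ↔⇒≅ adjacent = record
    { to = to ; from = from ; from∘to = strictlyInverseʳ ; to∘from = strictlyInverseˡ ; adjacent = adjacent }

  centres⇒≅ : {R : V → V → Set} {S : W → W → Set} {c : V} {d : W} →
             to c ≡ d → IsCentre R c → IsCentre S d → R ≅ S
  centres⇒≅ c↦d R-centre S-centre =
    ↔⇒≅ λ x y → ⇔.trans (R-centre x y) (⇔.trans (↔-preserves-Spoke c↦d) (⇔.sym (S-centre (to x) (to y))))

≅⇒↔ : ∀ {V W : Set} {R : V → V → Set} {S : W → W → Set} → R ≅ S → V ↔ W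
≅⇒↔ φ = mk↔ₛ′ to from to∘from from∘to
  where open _≅_ φ

≅-reflects-centre : ∀ {V W : Set} {R : V → V → Set} {S : W → W → Set} {d : W} →
                   (φ : R ≅ S) → IsCentre S d → IsCentre R (_≅_.from φ d)
≅-reflects-centre φ S-centre x y =
  ⇔.trans (adjacent x y) (⇔.trans (S-centre (to x) (to y)) (⇔.sym (↔-preserves-Spoke (≅⇒↔ φ) (to∘from _))))
  where open _≅_ φ

module _ {n : ℕ} (G : SimpleGraph n) where
  open Graph G

  centre-intro : ∀ {c} → (∀ u → u ≢ c → Adj G c u) → (∀ {u v} → Adj G u v → u ≡ c ⊎ v ≡ c) →
                 IsCentre (Adj G) c
  centre-intro spoke central x y = mk⇔ (λ xy → Adj⇒≢ xy , central xy) λ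
    { (x≢y , inj₁ refl) → spoke y (x≢y ∘ ≡.sym)
    ; (x≢y , inj₂ refl) → Adj-sym (spoke x x≢y) }

centre⇒IsStar : ∀ {m} (G : SimpleGraph (suc m)) {c} → IsCentre (Adj G) c → IsStar G
centre⇒IsStar {m} G {c} G-centre =
  m , centres⇒≅ (transpose c zero) (transpose-inverse c zero {zero}) G-centre StarGraph-centre

third-vertex : ∀ {n} → 3 ≤ n → (u v : Fin n) → ∃ λ w → w ≢ u × w ≢ v
third-vertex (s≤s (s≤s (s≤s _))) zero          zero          = suc zero , (λ ()) , (λ ())
third-vertex (s≤s (s≤s (s≤s _))) zero          (suc zero)    = suc (suc zero) , (λ ()) , (λ ())
third-vertex (s≤s (s≤s (s≤s _))) zero          (suc (suc _)) = suc zero , (λ ()) , (λ ())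
third-vertex (s≤s (s≤s (s≤s _))) (suc zero)    zero          = suc (suc zero) , (λ ()) , (λ ())
third-vertex (s≤s (s≤s (s≤s _))) (suc zero)    (suc _)       = zero , (λ ()) , (λ ())
third-vertex (s≤s (s≤s (s≤s _))) (suc (suc _)) zero          = suc zero , (λ ()) , (λ ())
third-vertex (s≤s (s≤s (s≤s _))) (suc (suc _)) (suc _)       = zero , (λ ()) , (λ ())

module Connected {n : ℕ} (G : SimpleGraph n) (3≤n : 3 ≤ n) (connected : Connected G) where
  open Graph G

  neighbour : ∀ u → ∃ (Adj G u)
  neighbour u with third-vertex 3≤n u u
  ... | w , w≢u , _ = first-step (connected u w) w≢u
    where
    first-step : ∀ {a b} → Star (Adj G) a b → b ≢ a → ∃ (Adj G a)
    first-step ε        b≢a = ⊥-elim (b≢a refl)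
    first-step (ax ◅ _) _   = _ , ax

  -- Follow a walk from u to a third vertex: its first step out of {u, v} extends an arc of uv.
  some-orientation-shunts : ∀ {u v} → Adj G u v → CanShunt u v ⊎ CanShunt v u
  some-orientation-shunts {u} {v} uv with third-vertex 3≤n u v
  ... | w , w≢u , w≢v = leave (inj₁ refl) (connected u w)
    where
    leave : ∀ {a} → a ≡ u ⊎ a ≡ v → Star (Adj G) a w → CanShunt u v ⊎ CanShunt v u
    leave (inj₁ w≡u) ε = ⊥-elim (w≢u w≡u)
    leave (inj₂ w≡v) ε = ⊥-elim (w≢v w≡v)
    leave (inj₁ refl) (_◅_ {j = x} ux walk) with x ≟ v
    ... | yes refl = leave (inj₂ refl) walk
    ... | no x≢v   = inj₂ (canShunt (Adj-sym uv) x≢v ux)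
    leave (inj₂ refl) (_◅_ {j = x} vx walk) with x ≟ u
    ... | yes refl = leave (inj₁ refl) walk
    ... | no x≢u   = inj₁ (canShunt uv x≢u vx)

  shuntingArc : Edge G → A1Vertex G
  shuntingArc ((u , v) , _ , uv) with some-orientation-shunts uv
  ... | inj₁ s = (u , v) , uv , s
  ... | inj₂ s = (v , u) , Adj-sym uv , s

  arcEdge-shuntingArc : ∀ e → arcEdge (shuntingArc e) ≡ e
  arcEdge-shuntingArc ((u , v) , _ , uv) with some-orientation-shunts uv
  ... | inj₁ _ = Joins-unique (edgeOf-joins u v uv) (forwards refl)
  ... | inj₂ _ = Joins-unique (Joins-sym (edgeOf-joins v u (Adj-sym uv))) (forwards refl)

  module _ (iso : A1Adj G ≅ LAdj G) where
    open _≅_ iso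

    to-shuntingArc-injective : Injective _≡_ _≡_ (to ∘ shuntingArc)
    to-shuntingArc-injective {e} {f} eq = begin
      e                          ≡⟨ ≡.sym (arcEdge-shuntingArc e) ⟩
      arcEdge (shuntingArc e)    ≡⟨ cong arcEdge (↔-injective (≅⇒↔ iso) eq) ⟩
      arcEdge (shuntingArc f)    ≡⟨ arcEdge-shuntingArc f ⟩
      f                          ∎
      where open ≡.≡-Reasoning

    unchosen-arc-missed : ∀ x → x ≢ shuntingArc (arcEdge x) → Misses (to ∘ shuntingArc) (to x)
    unchosen-arc-missed x x≢chosen e eq = x≢chosen (begin
      x                          ≡⟨ ≡.sym chosen≡x ⟩
      shuntingArc e              ≡⟨ cong shuntingArc e≡edge ⟩
      shuntingArc (arcEdge x)    ∎)
      where
      open ≡.≡-Reasoning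
      chosen≡x : shuntingArc e ≡ x
      chosen≡x = ↔-injective (≅⇒↔ iso) eq
      e≡edge : e ≡ arcEdge x
      e≡edge = trans (≡.sym (arcEdge-shuntingArc e)) (cong arcEdge chosen≡x)

    every-arc-chosen : ∀ x → ¬ x ≢ shuntingArc (arcEdge x)
    every-arc-chosen x = subset-injective⇒¬misses (↔-sym *↔×) IsEdge? IsEdge-irrelevant
      (to ∘ shuntingArc) to-shuntingArc-injective (to x) ∘ unchosen-arc-missed x

    ¬both-orientations-shunt : ∀ {u v} → Adj G u v → CanShunt u v → CanShunt v u → ⊥
    ¬both-orientations-shunt {u} {v} uv s s' =
      every-arc-chosen x λ x≡chosen → every-arc-chosen x' λ x'≡chosen →
        Adj⇒≢ uv (cong (proj₁ ∘ proj₁) (trans x≡chosen (trans (cong shuntingArc same-edge) (≡.sym x'≡chosen))))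
      where
      x x' : A1Vertex G
      x  = (u , v) , uv , s
      x' = (v , u) , Adj-sym uv , s'
      same-edge : arcEdge x ≡ arcEdge x'
      same-edge = Joins-unique (arcEdge-joins x) (Joins-sym (arcEdge-joins x'))

  module _ (¬both-shunt : ∀ {u v} → Adj G u v → CanShunt u v → CanShunt v u → ⊥) where

    shunting-head-centre : ∀ {v c} → Adj G v c → CanShunt v c → IsCentre (Adj G) c
    shunting-head-centre {v} {c} vc s = centre-intro G spoke central
      where
      into-centre : ∀ {y} → Adj G c y → CanShunt y c
      into-centre {y} cy with y ≟ v
      ... | yes refl = s
      ... | no y≢v   = canShunt (Adj-sym cy) (y≢v ∘ ≡.sym) (Adj-sym vc)

      leaf : ∀ {y z} → Adj G c y → Adj G y z → z ≡ c
      leaf {z = z} cy yz with z ≟ c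
      ... | yes z≡c = z≡c
      ... | no z≢c  = ⊥-elim (¬both-shunt cy (canShunt cy z≢c yz) (into-centre cy))

      reach : ∀ {a z} → a ≡ c ⊎ Adj G c a → Star (Adj G) a z → z ≡ c ⊎ Adj G c z
      reach near        ε            = near
      reach (inj₁ refl) (cz ◅ walk)  = reach (inj₂ cz) walk
      reach (inj₂ ca)   (az ◅ walk)  = reach (inj₁ (leaf ca az)) walk

      spoke : ∀ u → u ≢ c → Adj G c u
      spoke u u≢c with reach (inj₁ refl) (connected c u)
      ... | inj₁ u≡c = ⊥-elim (u≢c u≡c)
      ... | inj₂ cu  = cu

      central : ∀ {x y} → Adj G x y → x ≡ c ⊎ y ≡ c
      central {x} xy with x ≟ c
      ... | yes x≡c = inj₁ x≡c
      ... | no x≢c  = inj₂ (leaf (spoke x x≢c) xy)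

    has-centre : Fin n → ∃ (IsCentre (Adj G))
    has-centre u with x , ux ← neighbour u with some-orientation-shunts ux
    ... | inj₁ s = x , shunting-head-centre ux s
    ... | inj₂ s = u , shunting-head-centre (Adj-sym ux) s

share-centre : ∀ {n} {c u v u' v' : Fin n} → u ≡ c ⊎ v ≡ c → u' ≡ c ⊎ v' ≡ c → ShareVertex (u , v) (u' , v')
share-centre (inj₁ refl) (inj₁ refl) = inj₁ (inj₁ refl)
share-centre (inj₁ refl) (inj₂ refl) = inj₁ (inj₂ refl)
share-centre (inj₂ refl) (inj₁ refl) = inj₂ (inj₁ refl)
share-centre (inj₂ refl) (inj₂ refl) = inj₂ (inj₂ refl)

module StarShunting {n : ℕ} (G : SimpleGraph n) (3≤n : 3 ≤ n) {c : Fin n} (G-centre : IsCentre (Adj G) c) where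
  open Graph G

  spoke : ∀ {u} → u ≢ c → Adj G u c
  spoke u≢c = Equivalence.from (G-centre _ c) (u≢c , inj₂ refl)

  central : ∀ {u v} → Adj G u v → u ≡ c ⊎ v ≡ c
  central uv = proj₂ (Equivalence.to (G-centre _ _) uv)

  arc-head : (x : A1Vertex G) → proj₂ (proj₁ x) ≡ c
  arc-head ((u , v) , uv , s) with central uv
  ... | inj₂ v≡c = v≡c
  ... | inj₁ u≡c with w , w≢u , vw ← shuntTarget s with central vw
  ...   | inj₁ v≡c = v≡c
  ...   | inj₂ w≡c = ⊥-elim (w≢u (trans w≡c (≡.sym u≡c)))

  spokeArc : ∀ {u} → u ≢ c → A1Vertex G
  spokeArc {u} u≢c with third-vertex 3≤n u c
  ... | w , w≢u , w≢c = (u , c) , spoke u≢c , canShunt (spoke u≢c) w≢u (Adj-sym (spoke w≢c))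

  leafOf : (e : Edge G) → ∃ λ u → u ≢ c × Joins e u c
  leafOf ((a , b) , _ , ab) with a ≟ c
  ... | yes refl = b , (Adj⇒≢ ab ∘ ≡.sym) , backwards refl
  ... | no a≢c with central ab
  ...   | inj₁ a≡c  = ⊥-elim (a≢c a≡c)
  ...   | inj₂ refl = a , a≢c , forwards refl

  edgeArc : Edge G → A1Vertex G
  edgeArc e = spokeArc (proj₁ (proj₂ (leafOf e)))

  A1Vertex↔Edge : A1Vertex G ↔ Edge G
  A1Vertex↔Edge = mk↔ₛ′ arcEdge edgeArc arcEdge-edgeArc edgeArc-arcEdge
    where
    arcEdge-edgeArc : ∀ e → arcEdge (edgeArc e) ≡ e
    arcEdge-edgeArc e = Joins-unique (arcEdge-joins (edgeArc e)) (proj₂ (proj₂ (leafOf e)))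

    edgeArc-arcEdge : ∀ x → edgeArc (arcEdge x) ≡ x
    edgeArc-arcEdge x = A1Vertex-≡ (cong₂ _,_ leaf≡tail (≡.sym (arc-head x)))
      where
      leaf≡tail : proj₁ (leafOf (arcEdge x)) ≡ proj₁ (proj₁ x)
      leaf≡tail = Joins-injective (proj₂ (proj₂ (leafOf (arcEdge x))))
                                  (subst (Joins (arcEdge x) _) (arc-head x) (arcEdge-joins x))

  A1≅L : A1Adj G ≅ LAdj G
  A1≅L = ↔⇒≅ A1Vertex↔Edge λ x y → mk⇔
    (λ (x≢y , _) → x≢y ∘ ↔-injective A1Vertex↔Edge
                 , share-centre (central (proj₂ (proj₂ (arcEdge x)))) (central (proj₂ (proj₂ (arcEdge y)))))
    (λ (ex≢ey , _) → ex≢ey ∘ cong arcEdge , share-centre (inj₂ (arc-head x)) (inj₂ (arc-head y)))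

mainTheorem11 : (n : ℕ) (G : SimpleGraph n) → 3 ≤ n → Connected G →
    (A1Adj G ≅ LAdj G) ⇔ IsStar G
mainTheorem11 zero    G ()  _
mainTheorem11 (suc m) G 3≤n connected = mk⇔
  (λ iso → centre⇒IsStar G (proj₂ (has-centre (¬both-orientations-shunt iso) zero)))
  (λ (_ , φ) → StarShunting.A1≅L G 3≤n (≅-reflects-centre φ StarGraph-centre))
  where open Connected G 3≤n connected
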